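{- Let $p,q$ be propositional variables. Then ${\bf ITL}^0 \vdash {\rm CD}(p,q) \to {\rm BI}(p,q)$, i.e. \[ {\bf ITL}^0 \vdash \big(\Box(p\vee q)\to \Box p\vee\Diamond q\big)\to\big(\Box(p\vee q)\wedge\Box(\circ q\to q)\to \Box p\vee q\big). \]
   Context: Fix a countably infinite set $\mathbb P$ of propositional variables. The language $\mathcal L$ is given by the grammar $\varphi ::= \bot \mid p \mid \varphi\wedge\varphi \mid \varphi\vee\varphi\mid \varphi\to\varphi\mid \circ\varphi\mid\Diamond\varphi\mid\Box\varphi$ with $p\in\mathbb P$ ($\circ$ = next, $\Diamond$ = eventually, $\Box$ = henceforth); $\neg\varphi$ abbreviates $\varphi\to\bot$ and $\varphi\leftrightarrow\psi$ abbreviates $(\varphi\to\psi)\wedge(\psi\to\varphi)$. The logic ${\bf ITL}^0$ is the least set of $\mathcal L$-formulas containing all ($\mathcal L$-instances of) intuitionistic propositional tautologies and all instances of the schemes $\neg\circ\bot$; $\circ(\varphi\wedge\psi)\leftrightarrow(\circ\varphi\wedge\circ\psi)$; $\circ(\varphi\vee\psi)\leftrightarrow(\circ\varphi\vee\circ\psi)$; $\circ(\varphi\to\psi)\to(\circ\varphi\to\circ\psi)$; $\Box(\varphi\to\psi)\to(\Box\varphi\to\Box\psi)$; $\Box(\varphi\to\psi)\to(\Diamond\varphi\to\Diamond\psi)$; $\Diamond(\varphi\vee\psi)\to(\Diamond\varphi\vee\Diamond\psi)$; $\Box\varphi\to\varphi\wedge\circ\Box\varphi$; $\varphi\vee\circ\Diamond\varphi\to\Diamond\varphi$;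 and closed under the rules: from $\varphi\to\circ\varphi$ infer $\varphi\to\Box\varphi$; from $\circ\varphi\to\varphi$ infer $\Diamond\varphi\to\varphi$; from $\varphi$ and $\varphi\to\psi$ infer $\psi$; from $\varphi$ infer $\circ\varphi$. ${\bf ITL}^0\vdash\varphi$ means $\varphi\in{\bf ITL}^0$. The formulas ${\rm CD}(\varphi,\psi)$ and ${\rm BI}(\varphi,\psi)$ denote $\Box(\varphi\vee\psi)\to\Box\varphi\vee\Diamond\psi$ and $\Box(\varphi\vee\psi)\wedge\Box(\circ\psi\to\psi)\to\Box\varphi\vee\psi$ respectively. -}

module Defs where

open import Data.Nat using (ℕ)

Var : Set
Var = ℕ

infixr 4 _⇒_
infixr 5 _∨ᶠ_
infixr 6 _∧ᶠ_
data Form : Set where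
  ⊥ᶠ   : Form
  var  : Var → Form
  _∧ᶠ_ : Form → Form → Form
  _∨ᶠ_ : Form → Form → Form
  _⇒_  : Form → Form → Form
  ○    : Form → Form
  ◇    : Form → Form
  □    : Form → Form

¬ᶠ_ : Form → Form
¬ᶠ φ = φ ⇒ ⊥ᶠ

_⇔_ : Form → Form → Form
φ ⇔ ψ = (φ ⇒ ψ) ∧ᶠ (ψ ⇒ φ)

-- Intuitionistic propositional tautologies (all 𝓛-instances) are generated
-- by a standard complete Hilbert axiomatisation of IPC together with modus
-- ponens (which ITL⁰ is closed under anyway).
data ITL⁰⊢_ : Form → Set where
  ipc-k    : ∀ φ ψ → ITL⁰⊢ (φ ⇒ ψ ⇒ φ)
  ipc-s    : ∀ φ ψ χ → ITL⁰⊢ ((φ ⇒ ψ ⇒ χ) ⇒ (φ ⇒ ψ) ⇒ φ ⇒ χ)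
  ipc-∧e₁  : ∀ φ ψ → ITL⁰⊢ (φ ∧ᶠ ψ ⇒ φ)
  ipc-∧e₂  : ∀ φ ψ → ITL⁰⊢ (φ ∧ᶠ ψ ⇒ ψ)
  ipc-∧i   : ∀ φ ψ → ITL⁰⊢ (φ ⇒ ψ ⇒ φ ∧ᶠ ψ)
  ipc-∨i₁  : ∀ φ ψ → ITL⁰⊢ (φ ⇒ φ ∨ᶠ ψ)
  ipc-∨i₂  : ∀ φ ψ → ITL⁰⊢ (ψ ⇒ φ ∨ᶠ ψ)
  ipc-∨e   : ∀ φ ψ χ → ITL⁰⊢ ((φ ⇒ χ) ⇒ (ψ ⇒ χ) ⇒ φ ∨ᶠ ψ ⇒ χ)
  ipc-⊥e   : ∀ φ → ITL⁰⊢ (⊥ᶠ ⇒ φ)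
  ax-○⊥    : ITL⁰⊢ (¬ᶠ ○ ⊥ᶠ)
  ax-○∧    : ∀ φ ψ → ITL⁰⊢ (○ (φ ∧ᶠ ψ) ⇔ (○ φ ∧ᶠ ○ ψ))
  ax-○∨    : ∀ φ ψ → ITL⁰⊢ (○ (φ ∨ᶠ ψ) ⇔ (○ φ ∨ᶠ ○ ψ))
  ax-○⇒    : ∀ φ ψ → ITL⁰⊢ (○ (φ ⇒ ψ) ⇒ (○ φ ⇒ ○ ψ))
  ax-□K    : ∀ φ ψ → ITL⁰⊢ (□ (φ ⇒ ψ) ⇒ (□ φ ⇒ □ ψ))
  ax-◇K    : ∀ φ ψ → ITL⁰⊢ (□ (φ ⇒ ψ) ⇒ (◇ φ ⇒ ◇ ψ))
  ax-◇∨    : ∀ φ ψ → ITL⁰⊢ (◇ (φ ∨ᶠ ψ) ⇒ (◇ φ ∨ᶠ ◇ ψ))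
  ax-□fix  : ∀ φ → ITL⁰⊢ (□ φ ⇒ φ ∧ᶠ ○ (□ φ))
  ax-◇fix  : ∀ φ → ITL⁰⊢ (φ ∨ᶠ ○ (◇ φ) ⇒ ◇ φ)
  ind-□    : ∀ {φ} → ITL⁰⊢ (φ ⇒ ○ φ) → ITL⁰⊢ (φ ⇒ □ φ)
  ind-◇    : ∀ {φ} → ITL⁰⊢ (○ φ ⇒ φ) → ITL⁰⊢ (◇ φ ⇒ φ)
  mp       : ∀ {φ ψ} → ITL⁰⊢ φ → ITL⁰⊢ (φ ⇒ ψ) → ITL⁰⊢ ψ
  nec-○    : ∀ {φ} → ITL⁰⊢ φ → ITL⁰⊢ (○ φ)

CD : Form → Form → Form
CD φ ψ = □ (φ ∨ᶠ ψ) ⇒ □ φ ∨ᶠ ◇ ψ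

BI : Form → Form → Form
BI φ ψ = □ (φ ∨ᶠ ψ) ∧ᶠ □ (○ ψ ⇒ ψ) ⇒ □ φ ∨ᶠ ψ

module Submission where

open import Defs

-- Write R = ○q → q.  The heart of the argument is a general
-- "backward induction" principle of ITL⁰: for every formula ψ,
--     ◇ψ → □(○ψ → ψ) → ψ .
-- It holds because χ = □(○ψ → ψ) → ψ satisfies ○χ → χ (unfold □ once and
-- use the next-step instance of χ), so the ◇-induction rule gives ◇χ → χ,
-- while ψ → χ yields ◇ψ → ◇χ.  The proposition then follows: from
-- □(p ∨ q) the hypothesis CD(p,q) gives □p ∨ ◇q; in the first case □p ∨ q
-- holds at once, in the second backward induction with □R gives q.

-- Hypothesis lists; Γ ⊢ φ means ITL⁰ proves A₁ ⇒ A₂ ⇒ … ⇒ Aₙ ⇒ φ.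
infixl 3 _,,_
data Ctx : Set where
  ε    : Ctx
  _,,_ : Ctx → Form → Ctx

close : Ctx → Form → Form
close ε        φ = φ
close (Γ ,, A) φ = close Γ (A ⇒ φ)

infix 2 _⊢_
_⊢_ : Ctx → Form → Set
Γ ⊢ φ = ITL⁰⊢ (close Γ φ)

⇒-refl : ∀ φ → ITL⁰⊢ (φ ⇒ φ)
⇒-refl φ = mp (ipc-k φ φ) (mp (ipc-k φ (φ ⇒ φ)) (ipc-s φ (φ ⇒ φ) φ))

lift : ∀ Γ {φ} → ITL⁰⊢ φ → Γ ⊢ φ
lift ε        d = d
lift (Γ ,, A) {φ} d = lift Γ (mp d (ipc-k φ A))

app : ∀ Γ {φ ψ} → Γ ⊢ (φ ⇒ ψ) → Γ ⊢ φ → Γ ⊢ ψ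
app ε        f x = mp x f
app (Γ ,, A) {φ} {ψ} f x = app Γ (app Γ (lift Γ (ipc-s A φ ψ)) f) x

assume : ∀ Γ {A} → Γ ,, A ⊢ A
assume Γ {A} = lift Γ (⇒-refl A)

weaken : ∀ Γ {A φ} → Γ ⊢ φ → Γ ,, A ⊢ φ
weaken Γ {A} {φ} d = app Γ (lift Γ (ipc-k φ A)) d

use : ∀ Γ {φ ψ} → ITL⁰⊢ (φ ⇒ ψ) → Γ ⊢ φ → Γ ⊢ ψ
use Γ f x = app Γ (lift Γ f) x

use₂ : ∀ Γ {φ ψ χ} → ITL⁰⊢ (φ ⇒ ψ ⇒ χ) → Γ ⊢ φ → Γ ⊢ ψ → Γ ⊢ χ
use₂ Γ f x y = app Γ (use Γ f x) y

-- Necessitation for □: a theorem φ satisfies φ ⇒ ○φ, so □-induction applies.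
□-nec : ∀ {φ} → ITL⁰⊢ φ → ITL⁰⊢ (□ φ)
□-nec {φ} d = mp d (ind-□ (mp (nec-○ d) (ipc-k (○ φ) φ)))

backward-induction : ∀ ψ → ITL⁰⊢ (◇ ψ ⇒ □ (○ ψ ⇒ ψ) ⇒ ψ)
backward-induction ψ = use Γ (ind-◇ χ-backward-closed) eventually-χ
  where
    R = ○ ψ ⇒ ψ
    χ = □ R ⇒ ψ
    Γ = ε ,, ◇ ψ

    -- ○χ ⇒ χ: from □R we get R now and □R at the next step, hence ○ψ and ψ.
    χ-backward-closed : ITL⁰⊢ (○ χ ⇒ χ)
    χ-backward-closed = app Δ R-now ψ-next
      where
        Δ = ε ,, ○ χ ,, □ R
        unfolded : Δ ⊢ R ∧ᶠ ○ (□ R)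
        unfolded = use Δ (ax-□fix R) (assume (ε ,, ○ χ))
        R-now : Δ ⊢ R
        R-now = use Δ (ipc-∧e₁ R (○ (□ R))) unfolded
        ψ-next : Δ ⊢ ○ ψ
        ψ-next = use₂ Δ (ax-○⇒ (□ R) ψ) (weaken (ε ,, ○ χ) (assume ε))
                        (use Δ (ipc-∧e₂ R (○ (□ R))) unfolded)

    -- ◇ψ ⇒ ◇χ, since ψ ⇒ χ holds always.
    eventually-χ : Γ ⊢ ◇ χ
    eventually-χ = use₂ Γ (ax-◇K ψ χ) (lift Γ (□-nec (ipc-k ψ (□ R)))) (assume ε)

proposition2p1 : (p q : Var) → ITL⁰⊢ (CD (var p) (var q) ⇒ BI (var p) (var q))
proposition2p1 p q =
  app Γ (use₂ Γ (ipc-∨e (□ P) (◇ Q) goal) (lift Γ (ipc-∨i₁ (□ P) Q)) from-◇Q) □P-or-◇Q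
  where
    P = var p
    Q = var q
    goal = □ P ∨ᶠ Q
    Γ = ε ,, CD P Q ,, □ (P ∨ᶠ Q) ∧ᶠ □ (○ Q ⇒ Q)

    always-P∨Q : Γ ⊢ □ (P ∨ᶠ Q)
    always-P∨Q = use Γ (ipc-∧e₁ (□ (P ∨ᶠ Q)) (□ (○ Q ⇒ Q))) (assume (ε ,, CD P Q))

    always-backward : Γ ⊢ □ (○ Q ⇒ Q)
    always-backward = use Γ (ipc-∧e₂ (□ (P ∨ᶠ Q)) (□ (○ Q ⇒ Q))) (assume (ε ,, CD P Q))

    □P-or-◇Q : Γ ⊢ □ P ∨ᶠ ◇ Q
    □P-or-◇Q = app Γ (weaken (ε ,, CD P Q) (assume ε)) always-P∨Q

    from-◇Q : Γ ⊢ (◇ Q ⇒ goal)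
    from-◇Q = use (Γ ,, ◇ Q) (ipc-∨i₂ (□ P) Q)
                (use₂ (Γ ,, ◇ Q) (backward-induction Q) (assume Γ) (weaken Γ always-backward))
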